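{- Let $n\ge1$. In unlabeled chip-firing on the infinite binary tree with a self-loop at the root, starting with $2^n-1$ chips at the root, the terminal configuration has exactly one chip at every node on levels $1,\dots,n$ and no chip at any other node.
   Context: The infinite binary tree has nodes labeled by positive integers: node $1$ is the root, node $i$ has children $2i$ and $2i+1$ and (for $i>1$) parent $\lfloor i/2\rfloor$. A self-loop is added at the root, so every node has degree $3$. The level of node $i$ is $\lfloor\log_2 i\rfloor+1$. Unlabeled chip-firing: a node with at least $3$ (indistinguishable) chips may fire, sending one chip to each of its two children and one to its parent (the root sends this chip to itself). A configuration is terminal if no node has $3$ or more chips; the process terminates in a unique terminal configuration. -}

module Defs where

open import Data.Nat using (ℕ; zero; suc; _+_; _∸_; _^_; _≤_; _<_; _≤ᵇ_; _<ᵇ_; _≡ᵇ_; _/_; _*_)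
open import Data.Bool using (Bool; true; false; if_then_else_; _∧_; _∨_)
open import Data.Product using (Σ; _×_; ∃)
open import Relation.Binary.PropositionalEquality using (_≡_)
open import Relation.Binary.Construct.Closure.ReflexiveTransitive using (Star)

-- Nodes of the infinite binary tree are the positive integers; node i has
-- children 2i, 2i+1 and (for i > 1) parent ⌊i/2⌋; the root 1 has a self-loop.
-- A configuration assigns a number of chips to every label; label 0 is not a
-- node and always carries 0 chips in every configuration considered here.
Config : Set
Config = ℕ → ℕ

-- Result of firing node v (v ≥ 1) in configuration c: v loses 3 chips,
-- each child gains one, the parent gains one; for the root the parent chip
-- goes back to the root itself (net loss 2).
fire : Config → ℕ → Config
fire c v i =
  if i ≡ᵇ v
  then (if v ≡ᵇ 1 then c i ∸ 2 else c i ∸ 3)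
  else (if (i ≡ᵇ 2 * v) ∨ (i ≡ᵇ 2 * v + 1) ∨ ((1 <ᵇ v) ∧ (i ≡ᵇ v / 2))
        then c i + 1
        else c i)

Step : Config → Config → Set
Step c c' = Σ ℕ λ v → (1 ≤ v) × (3 ≤ c v) × (∀ i → c' i ≡ fire c v i)

Reach : Config → Config → Set
Reach = Star Step

Terminal : Config → Set
Terminal c = ∀ i → 1 ≤ i → c i < 3

initial : ℕ → Config
initial n i = if i ≡ᵇ 1 then 2 ^ n ∸ 1 else 0

-- Target: one chip on each node of level 1..n, i.e. on 1 ≤ i < 2^n.
-- (level i = ⌊log₂ i⌋ + 1 ≤ n  iff  i < 2^n)
target : ℕ → Config
target n i = if (1 ≤ᵇ i) ∧ (i <ᵇ 2 ^ n) then 1 else 0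

module Submission where

-- Firing all 2^k nodes of depth k once keeps a configuration constant on every depth, so the
-- process can be run on depth profiles: firing depth k gives one chip to each node of depth
-- k + 1 and two chips to each node of depth k - 1. On profiles, induction on m shows that a root
-- holding 2^(m+1) chips beyond its share, with one chip on each depth 1 … m, sends exactly one
-- more chip to every node of depth m + 1: two half-size rounds bring depth m + 1 to three chips
-- each, and a wave fired from depth m + 1 down to the root passes the surplus on. Starting from
-- 2^n - 1 chips this fills depths 0 … n - 1. The terminal configuration is unique by the least
-- action principle: the odometer of any legal run is bounded by every stabilizing odometer, so
-- two terminating runs have the same odometer and hence the same result.

open import Defs
open import Data.Bool using (true; false; if_then_else_; _∧_; _∨_)
open import Data.Bool.Properties using (∧-zeroʳ; ∨-identityʳ; T-≡)
open import Data.Empty using (⊥-elim)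
open import Data.Nat using (ℕ; zero; suc; _+_; _*_; _∸_; _^_; _≤_; _<_; _≡ᵇ_; _<ᵇ_; _≤ᵇ_; _/_; ⌊_/2⌋; z≤n; s≤s; s≤s⁻¹; _≤?_; _<?_; _≟_)
open import Data.Nat.DivMod using (m/n≡1+[m∸n]/n)
open import Data.Nat.Properties
open import Data.Nat.Tactic.RingSolver using (solve-∀)
open import Data.Product using (Σ; _×_; _,_; proj₁; proj₂)
open import Data.Sum using (_⊎_; inj₁; inj₂)
open import Function using (_∘_; Equivalence)
open import Relation.Binary.Construct.Closure.ReflexiveTransitive using (Star; ε; _◅_; _◅◅_)
open import Relation.Binary.Definitions using (tri<; tri≈; tri>)
open import Relation.Binary.PropositionalEquality
open import Relation.Nullary using (yes; no)

δ : ℕ → ℕ → ℕ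
δ zero    zero    = 1
δ zero    (suc n) = 0
δ (suc m) zero    = 0
δ (suc m) (suc n) = δ m n

δ-refl : ∀ n → δ n n ≡ 1
δ-refl zero    = refl
δ-refl (suc n) = δ-refl n

δ-≢ : ∀ {m n} → m ≢ n → δ m n ≡ 0
δ-≢ {zero}  {zero}  m≢n = ⊥-elim (m≢n refl)
δ-≢ {zero}  {suc n} _   = refl
δ-≢ {suc m} {zero}  _   = refl
δ-≢ {suc m} {suc n} m≢n = δ-≢ (m≢n ∘ cong suc)

δ-sym : ∀ m n → δ m n ≡ δ n m
δ-sym zero    zero    = refl
δ-sym zero    (suc n) = refl
δ-sym (suc m) zero    = refl
δ-sym (suc m) (suc n) = δ-sym m n

if-≡ᵇ : ∀ m n x → (if m ≡ᵇ n then x + 1 else x) ≡ x + δ m n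
if-≡ᵇ zero    zero    x = refl
if-≡ᵇ zero    (suc n) x = sym (+-identityʳ x)
if-≡ᵇ (suc m) zero    x = sym (+-identityʳ x)
if-≡ᵇ (suc m) (suc n) x = if-≡ᵇ m n x

≡ᵇ-refl : ∀ n → (n ≡ᵇ n) ≡ true
≡ᵇ-refl zero    = refl
≡ᵇ-refl (suc n) = ≡ᵇ-refl n

≡ᵇ-≢ : ∀ {m n} → m ≢ n → (m ≡ᵇ n) ≡ false
≡ᵇ-≢ {zero}  {zero}  m≢n = ⊥-elim (m≢n refl)
≡ᵇ-≢ {zero}  {suc n} _   = refl
≡ᵇ-≢ {suc m} {zero}  _   = refl
≡ᵇ-≢ {suc m} {suc n} m≢n = ≡ᵇ-≢ (m≢n ∘ cong suc)

n/2≡⌊n/2⌋ : ∀ n → n / 2 ≡ ⌊ n /2⌋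
n/2≡⌊n/2⌋ zero          = refl
n/2≡⌊n/2⌋ (suc zero)    = refl
n/2≡⌊n/2⌋ (suc (suc n)) =
  trans (m/n≡1+[m∸n]/n {suc (suc n)} {2} (s≤s (s≤s z≤n))) (cong suc (n/2≡⌊n/2⌋ n))

2*n≡n+n : ∀ n → 2 * n ≡ n + n
2*n≡n+n n = cong (n +_) (+-identityʳ n)

⌊2n/2⌋≡n : ∀ n → ⌊ 2 * n /2⌋ ≡ n
⌊2n/2⌋≡n zero    = refl
⌊2n/2⌋≡n (suc n) rewrite *-suc 2 n = cong suc (⌊2n/2⌋≡n n)

⌊2n+1/2⌋≡n : ∀ n → ⌊ 2 * n + 1 /2⌋ ≡ n
⌊2n+1/2⌋≡n zero    = refl
⌊2n+1/2⌋≡n (suc n) = trans (cong (λ m → ⌊ m + 1 /2⌋) (*-suc 2 n)) (cong suc (⌊2n+1/2⌋≡n n))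

⌊n/2⌋<m : ∀ {n m} → n < 2 * m → ⌊ n /2⌋ < m
⌊n/2⌋<m {n} {m} n<2m = subst (suc ⌊ n /2⌋ ≤_) (⌊2n+1/2⌋≡n m)
  (⌊n/2⌋-mono {suc (suc n)} (subst (suc (suc n) ≤_) (+-comm 1 (2 * m)) (s≤s n<2m)))

⌊n/2⌋<n⁺ : ∀ {n} → 1 ≤ n → ⌊ n /2⌋ < n
⌊n/2⌋<n⁺ {suc n} _ = ⌊n/2⌋<n n

n<2n⁺ : ∀ {n} → 1 ≤ n → n < 2 * n
n<2n⁺ {suc n} _ rewrite *-suc 2 n = s≤s (s≤s (m≤n*m n 2))

half-≡ᵇ : ∀ i v → (⌊ i /2⌋ ≡ᵇ v) ≡ ((i ≡ᵇ 2 * v) ∨ (i ≡ᵇ 2 * v + 1))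
half-≡ᵇ zero          zero    = refl
half-≡ᵇ (suc zero)    zero    = refl
half-≡ᵇ (suc (suc i)) zero    = refl
half-≡ᵇ i (suc v) = trans (at-suc i) (cong (λ m → (i ≡ᵇ m) ∨ (i ≡ᵇ m + 1)) (sym (*-suc 2 v)))
  where
  at-suc : ∀ i → (⌊ i /2⌋ ≡ᵇ suc v) ≡ ((i ≡ᵇ 2 + 2 * v) ∨ (i ≡ᵇ 2 + 2 * v + 1))
  at-suc zero          = refl
  at-suc (suc zero)    = refl
  at-suc (suc (suc i)) = half-≡ᵇ i v

δ-children : ∀ i v → δ (2 * i) v + δ (2 * i + 1) v ≡ δ ⌊ v /2⌋ i
δ-children zero    zero          = refl
δ-children zero    (suc zero)    = refl
δ-children zero    (suc (suc v)) = refl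
δ-children (suc i) v = trans (cong (λ m → δ m v + δ (m + 1) v) (*-suc 2 i)) (at-suc v)
  where
  at-suc : ∀ v → δ (2 + 2 * i) v + δ (2 + 2 * i + 1) v ≡ δ ⌊ v /2⌋ (suc i)
  at-suc zero          = refl
  at-suc (suc zero)    = refl
  at-suc (suc (suc v)) = δ-children i v

-- Odometers and the least action principle

-- Of the three chips fired by the root, one comes back along the self-loop.
firingLoss : ℕ → ℕ
firingLoss (suc zero) = 2
firingLoss _          = 3

firingLoss≤3 : ∀ i → firingLoss i ≤ 3
firingLoss≤3 zero          = ≤-refl
firingLoss≤3 (suc zero)    = s≤s (s≤s z≤n)
firingLoss≤3 (suc (suc i)) = ≤-refl

fromParent : (ℕ → ℕ) → ℕ → ℕ
fromParent u (suc (suc i)) = u ⌊ suc (suc i) /2⌋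
fromParent u _             = 0

fromChildren : (ℕ → ℕ) → ℕ → ℕ
fromChildren u i = u (2 * i) + u (2 * i + 1)

received : (ℕ → ℕ) → ℕ → ℕ
received u i = fromParent u i + fromChildren u i

-- The odometer equation c = c₀ + Δu on the nodes, written without subtraction.
record Odometer (c₀ : Config) (u : ℕ → ℕ) (c : Config) : Set where
  constructor odometer
  field balance : ∀ i → 1 ≤ i → c i + firingLoss i * u i ≡ c₀ i + received u i

open Odometer using (balance)

indicator : ℕ → ℕ → ℕ
indicator v i = δ i v

infixl 6 _⊕_
_⊕_ : (ℕ → ℕ) → (ℕ → ℕ) → ℕ → ℕ
(u ⊕ w) i = u i + w i

fromParent-≥2 : ∀ u {i} → 2 ≤ i → fromParent u i ≡ u ⌊ i /2⌋
fromParent-≥2 u {suc zero}    (s≤s ())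
fromParent-≥2 u {suc (suc i)} _ = refl

fromParent-below : ∀ u {lo i} → (∀ j → j < lo → u j ≡ 0) → i < 2 * lo → fromParent u i ≡ 0
fromParent-below u {i = zero}          _ _    = refl
fromParent-below u {i = suc zero}      _ _    = refl
fromParent-below u {i = suc (suc i)} u≡0 i<2lo = u≡0 _ (⌊n/2⌋<m i<2lo)

received-⊕ : ∀ u w i → received (u ⊕ w) i ≡ received u i + received w i
received-⊕ u w i = trans (cong (_+ fromChildren (u ⊕ w) i) (fromParent-⊕ i))
  (shuffle (fromParent u i) (fromParent w i) (u (2 * i)) (w (2 * i)) (u (2 * i + 1)) (w (2 * i + 1)))
  where
  fromParent-⊕ : ∀ i → fromParent (u ⊕ w) i ≡ fromParent u i + fromParent w i
  fromParent-⊕ zero          = refl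
  fromParent-⊕ (suc zero)    = refl
  fromParent-⊕ (suc (suc i)) = refl
  shuffle : ∀ a b c d e f → (a + b) + ((c + d) + (e + f)) ≡ (a + (c + e)) + (b + (d + f))
  shuffle = solve-∀

received-indicator-self : ∀ {v} → 1 ≤ v → received (indicator v) v ≡ 0
received-indicator-self {v} 1≤v = cong₂ _+_ parent children
  where
  parent : fromParent (indicator v) v ≡ 0
  parent = fromParent-below (indicator v) (λ j j<v → δ-≢ (<⇒≢ j<v)) (n<2n⁺ 1≤v)
  children : fromChildren (indicator v) v ≡ 0
  children = trans (δ-children v v) (δ-≢ (<⇒≢ (⌊n/2⌋<n⁺ 1≤v)))

fire-self : ∀ c {v} → 1 ≤ v → fire c v v ≡ c v ∸ firingLoss v
fire-self c {v} 1≤v rewrite ≡ᵇ-refl v = by-root v 1≤v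
  where
  by-root : ∀ v → 1 ≤ v → (if v ≡ᵇ 1 then c v ∸ 2 else c v ∸ 3) ≡ c v ∸ firingLoss v
  by-root (suc zero)    _ = refl
  by-root (suc (suc v)) _ = refl

-- Below v, node i can only be the parent of v; above v, only a child.
fire-other : ∀ c {i v} → 1 ≤ i → 1 ≤ v → i ≢ v → fire c v i ≡ c i + received (indicator v) i
fire-other c {i} {v} 1≤i 1≤v i≢v rewrite ≡ᵇ-≢ i≢v | n/2≡⌊n/2⌋ v | δ-children i v with <-cmp i v
... | tri≈ _ i≡v _ = ⊥-elim (i≢v i≡v)
... | tri< i<v _ _
  rewrite ≡ᵇ-≢ {i} {2 * v} (<⇒≢ (<-≤-trans i<v (m≤n*m v 2)))
        | ≡ᵇ-≢ {i} {2 * v + 1} (<⇒≢ (<-≤-trans i<v (≤-trans (m≤n*m v 2) (m≤m+n _ 1))))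
        | Equivalence.to T-≡ (<⇒<ᵇ (≤-<-trans 1≤i i<v))
        | fromParent-below (indicator v) (λ j j<i → δ-≢ (<⇒≢ (<-trans j<i i<v))) (n<2n⁺ 1≤i)
  = trans (if-≡ᵇ i ⌊ v /2⌋ (c i)) (cong (c i +_) (δ-sym i ⌊ v /2⌋))
... | tri> _ _ v<i
  rewrite ≡ᵇ-≢ {i} {⌊ v /2⌋} (>⇒≢ (≤-<-trans (⌊n/2⌋≤n v) v<i))
        | ∧-zeroʳ (1 <ᵇ v) | ∨-identityʳ (i ≡ᵇ 2 * v + 1) | sym (half-≡ᵇ i v)
        | δ-≢ {⌊ v /2⌋} {i} (<⇒≢ (≤-<-trans (⌊n/2⌋≤n v) v<i))
        | fromParent-≥2 (indicator v) (≤-<-trans 1≤v v<i)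
  = trans (if-≡ᵇ ⌊ i /2⌋ v (c i)) (cong (c i +_) (sym (+-identityʳ _)))

fire-odometer : ∀ c {v} → 1 ≤ v → 3 ≤ c v → Odometer c (indicator v) (fire c v)
fire-odometer c {v} 1≤v 3≤cv = odometer balance-at
  where
  balance-at : ∀ i → 1 ≤ i → fire c v i + firingLoss i * δ i v ≡ c i + received (indicator v) i
  balance-at i 1≤i with i ≟ v
  ... | yes refl = begin
    fire c i i + firingLoss i * δ i i      ≡⟨ cong₂ (λ x y → x + firingLoss i * y) (fire-self c 1≤i) (δ-refl i) ⟩
    c i ∸ firingLoss i + firingLoss i * 1  ≡⟨ cong (c i ∸ firingLoss i +_) (*-identityʳ (firingLoss i)) ⟩
    c i ∸ firingLoss i + firingLoss i      ≡⟨ m∸n+n≡m (≤-trans (firingLoss≤3 i) 3≤cv) ⟩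
    c i                                    ≡⟨ sym (+-identityʳ (c i)) ⟩
    c i + 0                                ≡⟨ cong (c i +_) (sym (received-indicator-self 1≤i)) ⟩
    c i + received (indicator i) i         ∎
    where open ≡-Reasoning
  ... | no i≢v = begin
    fire c v i + firingLoss i * δ i v            ≡⟨ cong₂ (λ x y → x + firingLoss i * y) (fire-other c 1≤i 1≤v i≢v) (δ-≢ i≢v) ⟩
    c i + received (indicator v) i + firingLoss i * 0 ≡⟨ cong (c i + received (indicator v) i +_) (*-zeroʳ (firingLoss i)) ⟩
    c i + received (indicator v) i + 0           ≡⟨ +-identityʳ _ ⟩
    c i + received (indicator v) i               ∎
    where open ≡-Reasoning

step-odometer : ∀ {c c'} (s : Step c c') → Odometer c (indicator (proj₁ s)) c'
step-odometer {c} (v , 1≤v , 3≤cv , c'≗fire) = odometer λ i 1≤i →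
  trans (cong (_+ firingLoss i * δ i v) (c'≗fire i)) (balance (fire-odometer c 1≤v 3≤cv) i 1≤i)

odometer-zero : ∀ c → Odometer c (λ _ → 0) c
odometer-zero c = odometer λ i _ → cong (c i +_) (trans (*-zeroʳ (firingLoss i)) (sym (received-zero i)))
  where
  received-zero : ∀ i → received (λ _ → 0) i ≡ 0
  received-zero zero          = refl
  received-zero (suc zero)    = refl
  received-zero (suc (suc i)) = refl

odometer-trans : ∀ {c₀ u c w c'} → Odometer c₀ u c → Odometer c w c' → Odometer c₀ (u ⊕ w) c'
odometer-trans {c₀} {u} {c} {w} {c'} c₀→c c→c' = odometer λ i 1≤i →
  let open ≡-Reasoning; L = firingLoss i in begin
  c' i + L * (u i + w i)               ≡⟨ cong (c' i +_) (*-distribˡ-+ L (u i) (w i)) ⟩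
  c' i + (L * u i + L * w i)           ≡⟨ x+[y+z]≡[x+z]+y (c' i) (L * u i) (L * w i) ⟩
  (c' i + L * w i) + L * u i           ≡⟨ cong (_+ L * u i) (balance c→c' i 1≤i) ⟩
  (c i + received w i) + L * u i       ≡⟨ sym (x+[y+z]≡[x+z]+y (c i) (L * u i) (received w i)) ⟩
  c i + (L * u i + received w i)       ≡⟨ sym (+-assoc (c i) (L * u i) (received w i)) ⟩
  (c i + L * u i) + received w i       ≡⟨ cong (_+ received w i) (balance c₀→c i 1≤i) ⟩
  (c₀ i + received u i) + received w i ≡⟨ +-assoc (c₀ i) (received u i) (received w i) ⟩
  c₀ i + (received u i + received w i) ≡⟨ cong (c₀ i +_) (sym (received-⊕ u w i)) ⟩
  c₀ i + received (u ⊕ w) i            ∎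
  where
  x+[y+z]≡[x+z]+y : ∀ x y z → x + (y + z) ≡ (x + z) + y
  x+[y+z]≡[x+z]+y = solve-∀

untouched : ∀ {c₀ u c v} → Odometer c₀ u c → 1 ≤ v → u v ≡ 0 → received u v ≡ 0 → c v ≡ c₀ v
untouched {c₀} {u} {c} {v} c₀→c 1≤v uv≡0 received≡0 = begin
  c v                        ≡⟨ sym (+-identityʳ (c v)) ⟩
  c v + 0                    ≡⟨ cong (c v +_) (sym (trans (cong (firingLoss v *_) uv≡0) (*-zeroʳ (firingLoss v)))) ⟩
  c v + firingLoss v * u v   ≡⟨ balance c₀→c v 1≤v ⟩
  c₀ v + received u v        ≡⟨ cong (c₀ v +_) received≡0 ⟩
  c₀ v + 0                   ≡⟨ +-identityʳ (c₀ v) ⟩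
  c₀ v                       ∎
  where open ≡-Reasoning

odometer-value : ∀ {c₀ u c i} → Odometer c₀ u c → 1 ≤ i → c i ≡ c₀ i + received u i ∸ firingLoss i * u i
odometer-value {c₀} {u} {c} {i} c₀→c 1≤i =
  trans (sym (m+n∸n≡m (c i) (firingLoss i * u i))) (cong (_∸ firingLoss i * u i) (balance c₀→c i 1≤i))

runOdometer : ∀ {c c'} → Star Step c c' → ℕ → ℕ
runOdometer ε       = λ _ → 0
runOdometer (s ◅ r) = indicator (proj₁ s) ⊕ runOdometer r

run-odometer : ∀ {c c'} (r : Star Step c c') → Odometer c (runOdometer r) c'
run-odometer ε       = odometer-zero _
run-odometer (_◅_ {j = c₁} s r) = odometer-trans {c = c₁} (step-odometer s) (run-odometer r)

infix 4 _≼_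
_≼_ : (ℕ → ℕ) → (ℕ → ℕ) → Set
u ≼ w = ∀ i → 1 ≤ i → u i ≤ w i

Stabilizing : Config → (ℕ → ℕ) → Set
Stabilizing c₀ w = ∀ i → 1 ≤ i → c₀ i + received w i < 3 + firingLoss i * w i

terminal-stabilizing : ∀ {c₀ u c} → Odometer c₀ u c → Terminal c → Stabilizing c₀ u
terminal-stabilizing {u = u} c₀→c terminal i 1≤i =
  subst (_< 3 + firingLoss i * u i) (balance c₀→c i 1≤i) (+-monoˡ-< (firingLoss i * u i) (terminal i 1≤i))

received-mono : ∀ {u w} → u ≼ w → ∀ i → 1 ≤ i → received u i ≤ received w i
received-mono {u} {w} u≼w i 1≤i =
  +-mono-≤ (parent i) (+-mono-≤ (u≼w (2 * i) (≤-trans 1≤i (m≤n*m i 2))) (u≼w (2 * i + 1) (m≤n+m 1 (2 * i))))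
  where
  parent : ∀ i → fromParent u i ≤ fromParent w i
  parent zero          = z≤n
  parent (suc zero)    = z≤n
  parent (suc (suc i)) = u≼w _ (s≤s z≤n)

-- If u v = w v, the odometer equation at v and stabilization by w force c v < 3.
fires-below : ∀ {c₀ u c w v} → Odometer c₀ u c → Stabilizing c₀ w → u ≼ w → 1 ≤ v → 3 ≤ c v → u v < w v
fires-below {c₀} {u} {c} {w} {v} c₀→c stab u≼w 1≤v 3≤cv with w v ≤? u v
... | no w≰u = ≰⇒> w≰u
... | yes w≤u = ⊥-elim (<⇒≱ (+-cancelʳ-< (L * w v) (c v) 3 c+Lw<3+Lw) 3≤cv)
  where
  open ≤-Reasoning
  L = firingLoss v
  c+Lw<3+Lw : c v + L * w v < 3 + L * w v
  c+Lw<3+Lw = begin-strict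
    c v + L * w v        ≡⟨ cong (λ x → c v + L * x) (≤-antisym w≤u (u≼w v 1≤v)) ⟩
    c v + L * u v        ≡⟨ balance c₀→c v 1≤v ⟩
    c₀ v + received u v  ≤⟨ +-monoʳ-≤ (c₀ v) (received-mono u≼w v 1≤v) ⟩
    c₀ v + received w v  <⟨ stab v 1≤v ⟩
    3 + L * w v          ∎

⊕-indicator-≼ : ∀ {u w v} → u ≼ w → u v < w v → u ⊕ indicator v ≼ w
⊕-indicator-≼ {u} {w} {v} u≼w uv<wv i 1≤i with i ≟ v
... | yes refl rewrite δ-refl i = subst (_≤ w i) (+-comm 1 (u i)) uv<wv
... | no i≢v rewrite δ-≢ i≢v | +-identityʳ (u i) = u≼w i 1≤i

least-action : ∀ {c₀ u c c' w} → Stabilizing c₀ w → Odometer c₀ u c → u ≼ w →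
               (r : Star Step c c') → u ⊕ runOdometer r ≼ w
least-action {u = u} stab c₀→c u≼w ε i 1≤i = subst (_≤ _) (sym (+-identityʳ (u i))) (u≼w i 1≤i)
least-action {u = u} {c = c} {w = w} stab c₀→c u≼w (_◅_ {j = c₁} s@(v , 1≤v , 3≤cv , _) r) i 1≤i =
  subst (_≤ w i) (+-assoc (u i) (δ i v) (runOdometer r i))
    (least-action stab (odometer-trans {c = c} {c' = c₁} c₀→c (step-odometer s))
      (⊕-indicator-≼ u≼w (fires-below c₀→c stab u≼w 1≤v 3≤cv)) r i 1≤i)

fire-label-0 : ∀ c {v} → 1 ≤ v → fire c v 0 ≡ c 0
fire-label-0 c {suc zero}    _ = refl
fire-label-0 c {suc (suc v)} _ rewrite n/2≡⌊n/2⌋ (suc (suc v)) = refl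

reach-label-0 : ∀ {c c'} → Reach c c' → c' 0 ≡ c 0
reach-label-0 ε                                = refl
reach-label-0 {c} ((v , 1≤v , _ , c'≗fire) ◅ r) =
  trans (reach-label-0 r) (trans (c'≗fire 0) (fire-label-0 c 1≤v))

terminal-unique : ∀ {c₀ T T'} → Reach c₀ T → Terminal T → Reach c₀ T' → Terminal T' → ∀ i → T i ≡ T' i
terminal-unique c₀→*T _ c₀→*T' _ zero = trans (reach-label-0 c₀→*T) (sym (reach-label-0 c₀→*T'))
terminal-unique {c₀} {T} {T'} c₀→*T T-terminal c₀→*T' T'-terminal i@(suc _) =
  +-cancelʳ-≡ (L * u i) (T i) (T' i) (begin
    T i + L * u i          ≡⟨ balance (run-odometer c₀→*T) i 1≤i ⟩
    c₀ i + received u i    ≡⟨ cong (c₀ i +_) (≤-antisym (received-mono u≼u' i 1≤i) (received-mono u'≼u i 1≤i)) ⟩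
    c₀ i + received u' i   ≡⟨ sym (balance (run-odometer c₀→*T') i 1≤i) ⟩
    T' i + L * u' i        ≡⟨ cong (λ x → T' i + L * x) (≤-antisym (u'≼u i 1≤i) (u≼u' i 1≤i)) ⟩
    T' i + L * u i         ∎)
  where
  open ≡-Reasoning
  1≤i = s≤s z≤n
  L   = firingLoss i
  u   = runOdometer c₀→*T
  u'  = runOdometer c₀→*T'
  u≼u' : u ≼ u'
  u≼u' = least-action (terminal-stabilizing (run-odometer c₀→*T') T'-terminal)
                      (odometer-zero c₀) (λ _ _ → z≤n) c₀→*T
  u'≼u : u' ≼ u
  u'≼u = least-action (terminal-stabilizing (run-odometer c₀→*T) T-terminal)
                      (odometer-zero c₀) (λ _ _ → z≤n) c₀→*T'

-- Depths

record AtDepth (k i : ℕ) : Set where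
  constructor bounds
  field
    lower : 2 ^ k ≤ i
    upper : i < 2 ^ suc k

depth-≥1 : ∀ {k i} → AtDepth k i → 1 ≤ i
depth-≥1 {k} (bounds 2^k≤i _) = ≤-trans (m^n>0 2 k) 2^k≤i

depth-0 : ∀ {i} → AtDepth 0 i → i ≡ 1
depth-0 {suc zero}    _                 = refl
depth-0 {suc (suc i)} (bounds _ (s≤s (s≤s ())))

depth-suc-≥2 : ∀ {k i} → AtDepth (suc k) i → 2 ≤ i
depth-suc-≥2 {k} (bounds 2^1+k≤i _) = ≤-trans (*-monoʳ-≤ 2 (m^n>0 2 k)) 2^1+k≤i

depth-children : ∀ {k i} → AtDepth k i → AtDepth (suc k) (2 * i) × AtDepth (suc k) (2 * i + 1)
depth-children {k} {i} (bounds 2^k≤i i<2^1+k) =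
  bounds 2^1+k≤2i (≤-<-trans (m≤m+n (2 * i) 1) 2i+1<2^2+k) , bounds (≤-trans 2^1+k≤2i (m≤m+n (2 * i) 1)) 2i+1<2^2+k
  where
  2^1+k≤2i : 2 ^ suc k ≤ 2 * i
  2^1+k≤2i = *-monoʳ-≤ 2 2^k≤i
  2i+1<2^2+k : 2 * i + 1 < 2 ^ suc (suc k)
  2i+1<2^2+k = subst (_≤ 2 ^ suc (suc k)) (trans (*-suc 2 i) (cong suc (+-comm 1 (2 * i))))
    (*-monoʳ-≤ 2 i<2^1+k)

depth-parent : ∀ {k i} → AtDepth (suc k) i → AtDepth k ⌊ i /2⌋
depth-parent {k} (bounds 2^1+k≤i i<2^2+k) =
  bounds (subst (_≤ _) (⌊2n/2⌋≡n (2 ^ k)) (⌊n/2⌋-mono 2^1+k≤i)) (⌊n/2⌋<m i<2^2+k)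

depth-unique : ∀ {k k' i} → AtDepth k i → AtDepth k' i → k ≡ k'
depth-unique {k} {k'} (bounds 2^k≤i i<2^1+k) (bounds 2^k'≤i i<2^1+k') with <-cmp k k'
... | tri< k<k' _ _ = ⊥-elim (<⇒≱ i<2^1+k (≤-trans (^-monoʳ-≤ 2 k<k') 2^k'≤i))
... | tri≈ _ k≡k' _ = k≡k'
... | tri> _ _ k'<k = ⊥-elim (<⇒≱ i<2^1+k' (≤-trans (^-monoʳ-≤ 2 k'<k) 2^k≤i))

n<2^n : ∀ n → n < 2 ^ n
n<2^n zero    = s≤s z≤n
n<2^n (suc n) = ≤-trans (subst (suc (suc n) ≤_) (sym (*-suc 2 n)) (s≤s (s≤s (m≤n*m n 2))))
                        (*-monoʳ-≤ 2 (n<2^n n))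

depth-below : ∀ n {i} → 1 ≤ i → i < 2 ^ n → Σ ℕ λ k → AtDepth k i
depth-below zero    1≤i i<1 = ⊥-elim (<⇒≱ i<1 1≤i)
depth-below (suc n) {i} 1≤i i<2^1+n with i <? 2 ^ n
... | yes i<2^n = depth-below n 1≤i i<2^n
... | no  i≮2^n = n , bounds (≮⇒≥ i≮2^n) i<2^1+n

depth : ∀ i → 1 ≤ i → Σ ℕ λ k → AtDepth k i
depth i 1≤i = depth-below i 1≤i (n<2^n i)

segment : ℕ → ℕ → ℕ → ℕ
segment lo zero    = λ _ → 0
segment lo (suc t) = segment lo t ⊕ indicator (lo + t)

lo+t<lo+1+t : ∀ lo t → lo + t < lo + suc t
lo+t<lo+1+t lo t = +-monoʳ-< lo (n<1+n t)

segment-outside : ∀ lo t {j} → j < lo ⊎ lo + t ≤ j → segment lo t j ≡ 0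
segment-outside lo zero    _ = refl
segment-outside lo (suc t) (inj₁ j<lo) =
  cong₂ _+_ (segment-outside lo t (inj₁ j<lo)) (δ-≢ (<⇒≢ (<-≤-trans j<lo (m≤m+n lo t))))
segment-outside lo (suc t) (inj₂ lo+1+t≤j) =
  cong₂ _+_ (segment-outside lo t (inj₂ (≤-trans (<⇒≤ (lo+t<lo+1+t lo t)) lo+1+t≤j)))
            (δ-≢ (>⇒≢ (<-≤-trans (lo+t<lo+1+t lo t) lo+1+t≤j)))

segment-inside : ∀ lo t {j} → lo ≤ j → j < lo + t → segment lo t j ≡ 1
segment-inside lo zero    lo≤j j<lo+0 = ⊥-elim (<⇒≱ j<lo+0 (subst (_≤ _) (sym (+-identityʳ lo)) lo≤j))
segment-inside lo (suc t) {j} lo≤j j<lo+1+t with j <? lo + t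
... | yes j<lo+t = cong₂ _+_ (segment-inside lo t lo≤j j<lo+t) (δ-≢ (<⇒≢ j<lo+t))
... | no  j≮lo+t = trans (cong₂ _+_ (segment-outside lo t (inj₂ lo+t≤j)) (cong (λ x → δ x (lo + t)) j≡lo+t))
                         (δ-refl (lo + t))
  where
  lo+t≤j = ≮⇒≥ j≮lo+t
  j≡lo+t : j ≡ lo + t
  j≡lo+t = ≤-antisym (s≤s⁻¹ (subst (suc j ≤_) (+-suc lo t) j<lo+1+t)) lo+t≤j

segment-end : ∀ lo t → t < lo → received (segment lo t) (lo + t) ≡ 0
segment-end lo t t<lo = cong₂ _+_ parent (cong₂ _+_ (segment-outside lo t (inj₂ v≤2v))
                                                    (segment-outside lo t (inj₂ (≤-trans v≤2v (m≤m+n _ 1)))))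
  where
  v≤2v = m≤n*m (lo + t) 2
  parent : fromParent (segment lo t) (lo + t) ≡ 0
  parent = fromParent-below (segment lo t) (λ j j<lo → segment-outside lo t (inj₁ j<lo))
             (subst (lo + t <_) (sym (2*n≡n+n lo)) (+-monoʳ-< lo t<lo))

depthIndicator : ℕ → ℕ → ℕ
depthIndicator k = segment (2 ^ k) (2 ^ k)

depthIndicator-δ : ∀ k {k' i} → AtDepth k' i → depthIndicator k i ≡ δ k k'
depthIndicator-δ k {k'} {i} i∈k' with k ≟ k'
... | yes refl = trans (segment-inside (2 ^ k) (2 ^ k) lower (subst (i <_) (2*n≡n+n (2 ^ k)) upper)) (sym (δ-refl k))
  where open AtDepth i∈k'
... | no  k≢k' = trans (segment-outside (2 ^ k) (2 ^ k) outside) (sym (δ-≢ k≢k'))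
  where
  outside : i < 2 ^ k ⊎ 2 ^ k + 2 ^ k ≤ i
  outside with i <? 2 ^ k | i <? 2 ^ k + 2 ^ k
  ... | yes i<2^k | _           = inj₁ i<2^k
  ... | no  _     | no  i≮2^1+k = inj₂ (≮⇒≥ i≮2^1+k)
  ... | no  i≮2^k | yes i<2^1+k =
    ⊥-elim (k≢k' (depth-unique (bounds (≮⇒≥ i≮2^k) (subst (i <_) (sym (2*n≡n+n (2 ^ k))) i<2^1+k)) i∈k'))

-- Depth profiles

Levelled : (ℕ → ℕ) → Config → Set
Levelled a c = ∀ k i → AtDepth k i → c i ≡ a k

levelLoss : ℕ → ℕ
levelLoss zero    = 2
levelLoss (suc _) = 3

-- Chips gained by each node of depth j when all nodes of depth k fire: one from the parent, one from each child.
levelReceived : ℕ → ℕ → ℕ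
levelReceived k j = δ j (suc k) + (δ (suc j) k + δ (suc j) k)

fireDepth : (ℕ → ℕ) → ℕ → ℕ → ℕ
fireDepth a k j = a j + levelReceived k j ∸ levelLoss j * δ k j

fireDepth-self : ∀ a k → fireDepth a k k ≡ a k ∸ levelLoss k
fireDepth-self a k rewrite δ-≢ (<⇒≢ (n<1+n k)) | δ-≢ (>⇒≢ (n<1+n k)) | δ-refl k
  | +-identityʳ (a k) | *-identityʳ (levelLoss k) = refl

fireDepth-up : ∀ a k → fireDepth a k (suc k) ≡ a (suc k) + 1
fireDepth-up a k rewrite δ-refl k | δ-≢ (>⇒≢ (m<n⇒m<1+n (n<1+n k))) | δ-≢ (<⇒≢ (n<1+n k)) = refl

fireDepth-down : ∀ a k → fireDepth a (suc k) k ≡ a k + 2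
fireDepth-down a k rewrite δ-≢ (<⇒≢ (≤-<-trans (n≤1+n k) (n<1+n (suc k)))) | δ-refl k | δ-≢ (>⇒≢ (n<1+n k))
  | *-zeroʳ (levelLoss k) = refl

fireDepth-far : ∀ a {k j} → j ≢ k → j ≢ suc k → suc j ≢ k → fireDepth a k j ≡ a j
fireDepth-far a {k} {j} j≢k j≢1+k 1+j≢k rewrite δ-≢ j≢1+k | δ-≢ 1+j≢k | δ-≢ (j≢k ∘ sym)
  | *-zeroʳ (levelLoss j) | +-identityʳ (a j) = refl

fireDepth-below : ∀ a {k j} → suc (suc j) ≤ k → fireDepth a k j ≡ a j
fireDepth-below a 2+j≤k = fireDepth-far a (<⇒≢ (≤-trans (n≤1+n _) 2+j≤k))
  (<⇒≢ (≤-trans (n≤1+n _) (≤-trans 2+j≤k (n≤1+n _)))) (<⇒≢ 2+j≤k)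

fireDepth-above : ∀ a {k j} → suc (suc k) ≤ j → fireDepth a k j ≡ a j
fireDepth-above a 2+k≤j = fireDepth-far a (>⇒≢ (≤-trans (n≤1+n _) 2+k≤j)) (>⇒≢ 2+k≤j)
  (>⇒≢ (≤-trans (n≤1+n _) (≤-trans 2+k≤j (n≤1+n _))))

DepthStep : (ℕ → ℕ) → (ℕ → ℕ) → Set
DepthStep a b = Σ ℕ λ k → 3 ≤ a k × (∀ j → b j ≡ fireDepth a k j)

DepthReach : (ℕ → ℕ) → (ℕ → ℕ) → Set
DepthReach = Star DepthStep

firingLoss-depth : ∀ {k i} → AtDepth k i → firingLoss i ≡ levelLoss k
firingLoss-depth {zero}  i∈0 rewrite depth-0 i∈0 = refl
firingLoss-depth {suc k} i∈1+k = at-≥2 (depth-suc-≥2 i∈1+k)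
  where
  at-≥2 : ∀ {i} → 2 ≤ i → firingLoss i ≡ 3
  at-≥2 {suc zero}    (s≤s ())
  at-≥2 {suc (suc i)} _ = refl

received-depthIndicator : ∀ k {k' i} → AtDepth k' i → received (depthIndicator k) i ≡ levelReceived k k'
received-depthIndicator k {k'} {i} i∈k' =
  cong₂ _+_ (parent k' i∈k') (cong₂ _+_ (child (proj₁ (depth-children i∈k'))) (child (proj₂ (depth-children i∈k'))))
  where
  D = depthIndicator k
  parent : ∀ k' → AtDepth k' i → fromParent D i ≡ δ k' (suc k)
  parent zero    i∈0    rewrite depth-0 i∈0 = refl
  parent (suc k') i∈1+k' =
    trans (fromParent-≥2 D (depth-suc-≥2 i∈1+k')) (trans (depthIndicator-δ k (depth-parent i∈1+k')) (δ-sym k k'))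
  child : ∀ {j} → AtDepth (suc k') j → D j ≡ δ (suc k') k
  child j∈1+k' = trans (depthIndicator-δ k j∈1+k') (δ-sym k (suc k'))

-- Nodes of equal depth are not adjacent, so they can be fired one after the other, each still
-- holding a k chips.
fire-depth : ∀ {a c k} → Levelled a c → 3 ≤ a k → Σ Config λ c' → Reach c c' × Levelled (fireDepth a k) c'
fire-depth {a} {c} {k} levelled 3≤ak =
  let (c' , c→*c' , c→c') = fire-segment (2 ^ k) ≤-refl
  in c' , c→*c' , λ k' i i∈k' → trans (odometer-value c→c' (depth-≥1 i∈k'))
       (cong₂ _∸_ (cong₂ _+_ (levelled k' i i∈k') (received-depthIndicator k i∈k'))
                  (cong₂ _*_ (firingLoss-depth i∈k') (depthIndicator-δ k i∈k')))
  where
  lo = 2 ^ k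
  fire-segment : ∀ t → t ≤ lo → Σ Config λ c' → Reach c c' × Odometer c (segment lo t) c'
  fire-segment zero    _    = c , ε , odometer-zero c
  fire-segment (suc t) t<lo =
    let (cₜ , c→*cₜ , c→cₜ) = fire-segment t (<⇒≤ t<lo)
        v∈k : AtDepth k (lo + t)
        v∈k = bounds (m≤m+n lo t) (subst (lo + t <_) (sym (2*n≡n+n lo)) (+-monoʳ-< lo t<lo))
        1≤v = depth-≥1 v∈k
        cₜv≡ak : cₜ (lo + t) ≡ a k
        cₜv≡ak = trans (untouched c→cₜ 1≤v (segment-outside lo t (inj₂ ≤-refl)) (segment-end lo t t<lo))
                       (levelled k (lo + t) v∈k)
        3≤cₜv : 3 ≤ cₜ (lo + t)
        3≤cₜv = subst (3 ≤_) (sym cₜv≡ak) 3≤ak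
    in fire cₜ (lo + t) , c→*cₜ ◅◅ ((lo + t , 1≤v , 3≤cₜv , λ _ → refl) ◅ ε) ,
       odometer-trans c→cₜ (fire-odometer cₜ 1≤v 3≤cₜv)

lift : ∀ {a b c} → Levelled a c → DepthReach a b → Σ Config λ c' → Reach c c' × Levelled b c'
lift {c = c} levelled ε = c , ε , levelled
lift {a} {c = c} levelled ((k , 3≤ak , b≗fire) ◅ a→*b) =
  let (c₁ , c→*c₁ , levelled₁) = fire-depth {a} {c} {k} levelled 3≤ak
      (c₂ , c₁→*c₂ , levelled₂) =
        lift {c = c₁} (λ k' i i∈k' → trans (levelled₁ k' i i∈k') (sym (b≗fire k'))) a→*b
  in c₂ , c→*c₁ ◅◅ c₁→*c₂ , levelled₂

OnesUpTo : ℕ → (ℕ → ℕ) → Set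
OnesUpTo m a = ∀ j → 1 ≤ j → j ≤ m → a j ≡ 1

OnesUpTo-suc : ∀ {m a} → OnesUpTo m a → a (suc m) ≡ 1 → OnesUpTo (suc m) a
OnesUpTo-suc {m} ones a[1+m]≡1 j 1≤j j≤1+m with j ≤? m
... | yes j≤m = ones j 1≤j j≤m
... | no  j≰m rewrite ≤-antisym j≤1+m (≰⇒> j≰m) = a[1+m]≡1

record Spill (m x : ℕ) (a : ℕ → ℕ) : Set where
  field
    result : ℕ → ℕ
    run    : DepthReach a result
    root   : result 0 ≡ x
    ones   : OnesUpTo m result
    next   : result (suc m) ≡ a (suc m) + 1
    beyond : ∀ j → suc m < j → result j ≡ a j

fire-root : ∀ {x a} → 1 ≤ x → a 0 ≡ x + 2 → Spill 0 x a
fire-root {x} {a} 1≤x a0≡x+2 = record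
  { result = fireDepth a 0
  ; run    = (0 , subst (3 ≤_) (sym a0≡x+2) (+-monoˡ-≤ 2 1≤x) , λ _ → refl) ◅ ε
  ; root   = trans (fireDepth-self a 0) (trans (cong (_∸ 2) a0≡x+2) (m+n∸n≡m x 2))
  ; ones   = λ { (suc zero) _ () ; (suc (suc _)) _ () }
  ; next   = fireDepth-up a 0
  ; beyond = λ j 1<j → fireDepth-above a 1<j
  }

spill-after-firing : ∀ {j x a} → a (suc j) ≡ 3 → Spill j x (fireDepth a (suc j)) → Spill (suc j) x a
spill-after-firing {j} {x} {a} a[1+j]≡3 S = record
  { result = result
  ; run    = (suc j , ≤-reflexive (sym a[1+j]≡3) , λ _ → refl) ◅ run
  ; root   = root
  ; ones   = OnesUpTo-suc ones (trans next (cong (_+ 1) (trans (fireDepth-self a (suc j)) (cong (_∸ 3) a[1+j]≡3))))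
  ; next   = trans (beyond (suc (suc j)) ≤-refl) (fireDepth-up a (suc j))
  ; beyond = λ i 2+j<i → trans (beyond i (<-trans (n<1+n _) 2+j<i)) (fireDepth-above a 2+j<i)
  }
  where
  open Spill S

-- Fires depths j + 1, j, …, 1, 0 in turn.
wave : ∀ j {x a} → 1 ≤ x → a 0 ≡ x → OnesUpTo j a → a (suc j) ≡ 3 → Spill (suc j) x a
wave zero    {x} {a} 1≤x a0≡x _ a1≡3 =
  spill-after-firing a1≡3 (fire-root 1≤x (trans (fireDepth-down a 0) (cong (_+ 2) a0≡x)))
wave (suc j) {x} {a} 1≤x a0≡x ones a[2+j]≡3 =
  spill-after-firing a[2+j]≡3
    (wave j 1≤x (trans (fireDepth-below a {suc (suc j)} (s≤s (s≤s z≤n))) a0≡x) ones′ a′[1+j]≡3)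
  where
  ones′ : OnesUpTo j (fireDepth a (suc (suc j)))
  ones′ i 1≤i i≤j = trans (fireDepth-below a (s≤s (s≤s i≤j))) (ones i 1≤i (≤-trans i≤j (n≤1+n j)))
  a′[1+j]≡3 : fireDepth a (suc (suc j)) (suc j) ≡ 3
  a′[1+j]≡3 = trans (fireDepth-down a (suc j)) (cong (_+ 2) (ones (suc j) (s≤s z≤n) ≤-refl))

-- The surplus 2^(m+2) is spent in two rounds of 2^(m+1), then a wave from depth m + 1.
push : ∀ m {x a} → 1 ≤ x → a 0 ≡ x + 2 ^ suc m → OnesUpTo m a → Spill m x a
push zero    1≤x a0≡x+2 _ = fire-root 1≤x a0≡x+2
push (suc m) {x} {a} 1≤x a0≡x+2^[2+m] ones = record
  { result = S₃.result
  ; run    = S₁.run ◅◅ S₂.run ◅◅ S₃.run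
  ; root   = S₃.root
  ; ones   = S₃.ones
  ; next   = trans S₃.next (cong (_+ 1) (trans (S₂.beyond (suc (suc m)) ≤-refl) (S₁.beyond (suc (suc m)) ≤-refl)))
  ; beyond = λ j 2+m<j → trans (S₃.beyond j 2+m<j)
                         (trans (S₂.beyond j (<-trans (n<1+n _) 2+m<j)) (S₁.beyond j (<-trans (n<1+n _) 2+m<j)))
  }
  where
  p = 2 ^ suc m
  ones′ : OnesUpTo m a
  ones′ i 1≤i i≤m = ones i 1≤i (≤-trans i≤m (n≤1+n m))
  S₁ : Spill m (x + p) a
  S₁ = push m (≤-trans 1≤x (m≤m+n x p))
         (trans a0≡x+2^[2+m] (trans (cong (x +_) (2*n≡n+n p)) (sym (+-assoc x p p)))) ones′
  module S₁ = Spill S₁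
  S₂ : Spill m x S₁.result
  S₂ = push m 1≤x S₁.root S₁.ones
  module S₂ = Spill S₂
  S₃ : Spill (suc m) x S₂.result
  S₃ = wave m 1≤x S₂.root S₂.ones
         (trans S₂.next (cong (_+ 1) (trans S₁.next (cong (_+ 1) (ones (suc m) (s≤s z≤n) ≤-refl)))))
  module S₃ = Spill S₃

record Filled (m z : ℕ) (a : ℕ → ℕ) : Set where
  field
    result : ℕ → ℕ
    run    : DepthReach a result
    root   : result 0 ≡ suc z
    ones   : OnesUpTo m result
    empty  : ∀ j → m < j → result j ≡ 0

fill : ∀ m {z a} → a 0 + 1 ≡ z + 2 ^ suc m → (∀ j → 1 ≤ j → a j ≡ 0) → Filled m z a
fill zero {z} {a} a0+1≡z+2 empty = record
  { result = a
  ; run    = ε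
  ; root   = +-cancelʳ-≡ 1 (a 0) (suc z) (trans a0+1≡z+2 (+-suc z 1))
  ; ones   = λ { (suc zero) _ () ; (suc (suc _)) _ () }
  ; empty  = empty
  }
fill (suc m) {z} {a} a0+1≡z+2^[2+m] empty = record
  { result = S.result
  ; run    = F.run ◅◅ S.run
  ; root   = S.root
  ; ones   = OnesUpTo-suc S.ones (trans S.next (cong (_+ 1) (F.empty (suc m) ≤-refl)))
  ; empty  = λ j 1+m<j → trans (S.beyond j 1+m<j) (F.empty j (<-trans (n<1+n m) 1+m<j))
  }
  where
  p = 2 ^ suc m
  F : Filled m (z + p) a
  F = fill m (trans a0+1≡z+2^[2+m] (trans (cong (z +_) (2*n≡n+n p)) (sym (+-assoc z p p)))) empty
  module F = Filled F
  S : Spill m (suc z) F.result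
  S = push m (s≤s z≤n) F.root F.ones
  module S = Spill S

initialDepths : ℕ → ℕ → ℕ
initialDepths n zero    = 2 ^ n ∸ 1
initialDepths n (suc _) = 0

initial-levelled : ∀ n → Levelled (initialDepths n) (initial n)
initial-levelled n zero    i i∈0   rewrite depth-0 i∈0 = refl
initial-levelled n (suc k) i i∈1+k rewrite ≡ᵇ-≢ (>⇒≢ (depth-suc-≥2 i∈1+k)) = refl

target-inside : ∀ {n k i} → AtDepth k i → k < n → target n i ≡ 1
target-inside {n} {k} {i} i∈k k<n
  rewrite Equivalence.to T-≡ (≤⇒≤ᵇ (depth-≥1 i∈k))
        | Equivalence.to T-≡ (<⇒<ᵇ (<-≤-trans (AtDepth.upper i∈k) (^-monoʳ-≤ 2 k<n))) = refl

target-outside : ∀ {n k i} → AtDepth k i → n ≤ k → target n i ≡ 0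
target-outside {n} {k} {i} i∈k n≤k with i <ᵇ 2 ^ n in i<ᵇ2^n
... | true  = ⊥-elim (<⇒≱ (<ᵇ⇒< i (2 ^ n) (Equivalence.from T-≡ i<ᵇ2^n))
                          (≤-trans (^-monoʳ-≤ 2 n≤k) (AtDepth.lower i∈k)))
... | false rewrite ∧-zeroʳ (1 ≤ᵇ i) = refl

target-terminal : ∀ n → Terminal (target n)
target-terminal n i _ with (1 ≤ᵇ i) ∧ (i <ᵇ 2 ^ n)
... | true  = s≤s (s≤s z≤n)
... | false = s≤s z≤n

reach-target : ∀ m → Σ Config λ C → Reach (initial (suc m)) C × (∀ i → C i ≡ target (suc m) i)
reach-target m = C , initial→*C , C≡target
  where
  F : Filled m 0 (initialDepths (suc m))
  F = fill m (m∸n+n≡m (m^n>0 2 (suc m))) λ { (suc _) _ → refl }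
  module F = Filled F
  lifted = lift (initial-levelled (suc m)) F.run
  C = proj₁ lifted
  initial→*C = proj₁ (proj₂ lifted)
  C-levelled = proj₂ (proj₂ lifted)
  C≡target : ∀ i → C i ≡ target (suc m) i
  C≡target zero = reach-label-0 initial→*C
  C≡target (suc i) with depth (suc i) (s≤s z≤n)
  ... | k , i∈k with k ≤? m
  ...   | yes k≤m = trans (C-levelled k (suc i) i∈k) (trans (filled k k≤m) (sym (target-inside i∈k (s≤s k≤m))))
    where
    filled : ∀ k → k ≤ m → F.result k ≡ 1
    filled zero    _   = F.root
    filled (suc k) k<m = F.ones (suc k) (s≤s z≤n) k<m
  ...   | no  k≰m =
    trans (C-levelled k (suc i) i∈k) (trans (F.empty k (≰⇒> k≰m)) (sym (target-outside i∈k (≰⇒> k≰m))))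

corollary3p5 : (n : ℕ) → 1 ≤ n →
    (Σ Config λ T → Reach (initial n) T × Terminal T)
    × (∀ T → Reach (initial n) T → Terminal T → ∀ i → T i ≡ target n i)
corollary3p5 (suc m) _ with reach-target m
... | C , initial→*C , C≡target =
  (C , initial→*C , C-terminal) ,
  λ T initial→*T T-terminal i → trans (terminal-unique initial→*T T-terminal initial→*C C-terminal i) (C≡target i)
  where
  C-terminal : Terminal C
  C-terminal i 1≤i = subst (_< 3) (sym (C≡target i)) (target-terminal (suc m) i 1≤i)
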